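{- If $\mathbb{Z}$ is definable in the field $\mathbb{Q}$ by an existential first-order formula in the language of rings, then $\mathbb{Z}$ is also definable in $\mathbb{Q}$ by a universal first-order formula in the language of rings.
   Context: The language of rings is $\{+,\cdot;0,1\}$. An existential (resp. universal) formula is one of the form $\exists y_1\ldots\exists y_m\,\varphi$ (resp. $\forall y_1\ldots\forall y_m\,\varphi$) with $\varphi$ quantifier-free. -}

module Defs where

open import Data.Nat using (ℕ; suc)
open import Data.Fin using (Fin)
open import Data.Integer using (ℤ)
open import Data.Rational using (ℚ; _/_; 0ℚ; 1ℚ; _+_; _*_)
open import Data.Product using (Σ; _×_)
open import Data.Sum using (_⊎_)
open import Data.Empty using (⊥)
open import Data.Unit using (⊤)
open import Relation.Nullary using (¬_)
open import Relation.Binary.PropositionalEquality using (_≡_)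
open import Data.Vec.Functional using (Vector; _∷_)
open import Function.Bundles using (_⇔_)

data Term (n : ℕ) : Set where
  var  : Fin n → Term n
  zero′ one′ : Term n
  _⊕_ _⊗_ : Term n → Term n → Term n

data QF (n : ℕ) : Set where
  tt′ ff′ : QF n
  _≐_ : Term n → Term n → QF n
  ¬′_ : QF n → QF n
  _∧′_ _∨′_ : QF n → QF n → QF n

evalT : ∀ {n} → Vector ℚ n → Term n → ℚ
evalT ρ (var i) = ρ i
evalT ρ zero′ = 0ℚ
evalT ρ one′ = 1ℚ
evalT ρ (s ⊕ t) = evalT ρ s + evalT ρ t
evalT ρ (s ⊗ t) = evalT ρ s * evalT ρ t

Sat : ∀ {n} → Vector ℚ n → QF n → Set
Sat ρ tt′ = ⊤
Sat ρ ff′ = ⊥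
Sat ρ (s ≐ t) = evalT ρ s ≡ evalT ρ t
Sat ρ (¬′ φ) = ¬ Sat ρ φ
Sat ρ (φ ∧′ ψ) = Sat ρ φ × Sat ρ ψ
Sat ρ (φ ∨′ ψ) = Sat ρ φ ⊎ Sat ρ ψ

IsInt : ℚ → Set
IsInt q = Σ ℤ (λ z → q ≡ z / 1)

ExistentiallyDefinableℤ : Set
ExistentiallyDefinableℤ =
  Σ ℕ (λ m → Σ (QF (suc m)) (λ φ →
    (q : ℚ) → IsInt q ⇔ Σ (Vector ℚ m) (λ ys → Sat (q ∷ ys) φ)))

UniversallyDefinableℤ : Set
UniversallyDefinableℤ =
  Σ ℕ (λ m → Σ (QF (suc m)) (λ φ →
    (q : ℚ) → IsInt q ⇔ ((ys : Vector ℚ m) → Sat (q ∷ ys) φ)))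

{-# OPTIONS --safe #-}
module Submission where

-- A rational q is not an integer iff q = a/b for integers a, b, c, d with
-- ac + bd = 1 and b² ≠ 1: write q in lowest terms and use Bézout; conversely,
-- if q = z is an integer then a = zb and b(zc + d) = 1, so b is a unit.
-- Replacing each quantifier ∃ a ∈ ℤ by ∃ a ∃ ȳ φ(a, ȳ), for an existential
-- definition φ of ℤ, makes ℚ ∖ ℤ existentially definable; its negation is a
-- universal definition of ℤ.

open import Defs

open import Data.Nat as ℕ using (ℕ; zero; suc)
import Data.Nat.Properties as ℕP
import Data.Nat.Coprimality as ℕC
open import Data.Nat.GCD using (module Bézout)
open import Data.Fin using (Fin; zero; suc; combine; #_)
open import Data.Fin.Properties using (remQuot-combine; ∀-cons-⇔)
open import Data.Integer as ℤ using (ℤ; +_; -[1+_]; ∣_∣; 1ℤ; -1ℤ; _-_)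
import Data.Integer.Properties as ℤP
open import Data.Integer.Coprimality using (Coprime; coprime?)
open import Data.Integer.Solver using (module +-*-Solver)
open import Data.Rational as ℚ using (ℚ; mkℚ; _/_; ↥_; ↧_; 1ℚ)
open import Data.Rational.Literals using (fromℤ)
import Data.Rational.Properties as ℚP
import Data.Rational.Unnormalised as ℚᵘ
import Data.Rational.Unnormalised.Properties as ℚᵘP
open import Data.Product using (Σ; _,_; proj₁; proj₂; uncurry; swap)
open import Data.Product.Function.NonDependent.Propositional using (_×-⇔_)
open import Data.Sum using (_⊎_; inj₁; inj₂; [_,_]′)
open import Data.Sum.Function.Propositional using (_⊎-⇔_)
open import Data.Unit using (tt)
open import Data.Vec.Functional using (Vector; _∷_; []; map; concat)
open import Function using (_∘_; id; flip; const)
open import Function.Bundles using (_⇔_; mk⇔; Equivalence)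
import Function.Properties.Equivalence as ⇔
open import Function.Related.TypeIsomorphisms using (¬-cong-⇔)
open import Relation.Nullary using (¬_; contradiction)
open import Relation.Nullary.Decidable using (recompute)
open import Relation.Nullary.Negation using (¬∃⟶∀¬; ∀¬⟶¬∃)
open import Relation.Binary.PropositionalEquality

open Equivalence using (to; from)

renT : ∀ {k n} → (Fin k → Fin n) → Term k → Term n
renT f (var i) = var (f i)
renT f zero′ = zero′
renT f one′ = one′
renT f (s ⊕ t) = renT f s ⊕ renT f t
renT f (s ⊗ t) = renT f s ⊗ renT f t

renQ : ∀ {k n} → (Fin k → Fin n) → QF k → QF n
renQ f tt′ = tt′
renQ f ff′ = ff′
renQ f (s ≐ t) = renT f s ≐ renT f t
renQ f (¬′ φ) = ¬′ renQ f φ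
renQ f (φ ∧′ ψ) = renQ f φ ∧′ renQ f ψ
renQ f (φ ∨′ ψ) = renQ f φ ∨′ renQ f ψ

module _ {k n} {ρ : Vector ℚ n} {σ : Vector ℚ k} {f : Fin k → Fin n}
         (ρ∘f≗σ : ∀ i → ρ (f i) ≡ σ i) where

  evalT-renT : ∀ t → evalT ρ (renT f t) ≡ evalT σ t
  evalT-renT (var i) = ρ∘f≗σ i
  evalT-renT zero′ = refl
  evalT-renT one′ = refl
  evalT-renT (s ⊕ t) = cong₂ ℚ._+_ (evalT-renT s) (evalT-renT t)
  evalT-renT (s ⊗ t) = cong₂ ℚ._*_ (evalT-renT s) (evalT-renT t)

  Sat-renQ : ∀ φ → Sat ρ (renQ f φ) ⇔ Sat σ φ
  Sat-renQ tt′ = ⇔.refl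
  Sat-renQ ff′ = ⇔.refl
  Sat-renQ (s ≐ t) rewrite evalT-renT s | evalT-renT t = ⇔.refl
  Sat-renQ (¬′ φ) = ¬-cong-⇔ (Sat-renQ φ)
  Sat-renQ (φ ∧′ ψ) = Sat-renQ φ ×-⇔ Sat-renQ ψ
  Sat-renQ (φ ∨′ ψ) = Sat-renQ φ ⊎-⇔ Sat-renQ ψ

⋀ : ∀ {k n} → (Fin k → QF n) → QF n
⋀ {zero} φs = tt′
⋀ {suc k} φs = φs zero ∧′ ⋀ (φs ∘ suc)

Sat-⋀ : ∀ {k n} {ρ : Vector ℚ n} (φs : Fin k → QF n) → Sat ρ (⋀ φs) ⇔ (∀ i → Sat ρ (φs i))
Sat-⋀ {zero} φs = mk⇔ (λ _ ()) (const tt)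
Sat-⋀ {suc k} φs = ⇔.trans (⇔.refl ×-⇔ Sat-⋀ (φs ∘ suc)) ∀-cons-⇔

concat-combine : ∀ {a} {A : Set a} {m n} (xss : Vector (Vector A n) m) i j →
                 concat xss (combine i j) ≡ xss i j
concat-combine xss i j = cong (uncurry (flip xss) ∘ swap) (remQuot-combine i j)

ExDefinable : (ℚ → Set) → Set
ExDefinable P =
  Σ ℕ λ m → Σ (QF (suc m)) λ φ → (q : ℚ) → P q ⇔ Σ (Vector ℚ m) λ ys → Sat (q ∷ ys) φ

UnDefinable : (ℚ → Set) → Set
UnDefinable P =
  Σ ℕ λ m → Σ (QF (suc m)) λ φ → (q : ℚ) → P q ⇔ ((ys : Vector ℚ m) → Sat (q ∷ ys) φ)

UnDefinable-complement : ∀ {P Q : ℚ → Set} →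
  ExDefinable P → (∀ q → Q q ⇔ (¬ P q)) → UnDefinable Q
UnDefinable-complement (m , φ , def) Q⇔¬P =
  m , ¬′ φ , λ q → ⇔.trans (Q⇔¬P q) (⇔.trans (¬-cong-⇔ (def q)) (mk⇔ ¬∃⟶∀¬ ∀¬⟶¬∃))

module _ where
  open +-*-Solver
  open ≡-Reasoning

  i*j≡1⇒i*i≡1 : ∀ i j → i ℤ.* j ≡ 1ℤ → i ℤ.* i ≡ 1ℤ
  i*j≡1⇒i*i≡1 i j e = unit i (ℕP.m*n≡1⇒m≡1 ∣ i ∣ ∣ j ∣ (trans (sym (ℤP.abs-* i j)) (cong ∣_∣ e)))
    where
    unit : ∀ i → ∣ i ∣ ≡ 1 → i ℤ.* i ≡ 1ℤ
    unit (+ .1) refl = refl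
    unit -[1+ .0 ] refl = refl

  denominator-unit : ∀ z a b c d → z ℤ.* b ≡ a → a ℤ.* c ℤ.+ b ℤ.* d ≡ 1ℤ → b ℤ.* b ≡ 1ℤ
  denominator-unit z a b c d zb≡a ac+bd≡1 = i*j≡1⇒i*i≡1 b (z ℤ.* c ℤ.+ d) (begin
    b ℤ.* (z ℤ.* c ℤ.+ d)
      ≡⟨ solve 4 (λ z b c d → b :* (z :* c :+ d) := (z :* b) :* c :+ b :* d) refl z b c d ⟩
    (z ℤ.* b) ℤ.* c ℤ.+ b ℤ.* d
      ≡⟨ cong (λ t → t ℤ.* c ℤ.+ b ℤ.* d) zb≡a ⟩
    a ℤ.* c ℤ.+ b ℤ.* d
      ≡⟨ ac+bd≡1 ⟩
    1ℤ ∎)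

  1+yn≡xm⇒mx-ny≡1 : ∀ m n x y → 1 ℕ.+ y ℕ.* n ≡ x ℕ.* m → + m ℤ.* + x ℤ.+ + n ℤ.* ℤ.- + y ≡ 1ℤ
  1+yn≡xm⇒mx-ny≡1 m n x y eq = begin
    + m ℤ.* + x ℤ.+ + n ℤ.* ℤ.- + y
      ≡⟨ solve 4 (λ m n x y → m :* x :+ n :* (:- y) := x :* m :- y :* n) refl (+ m) (+ n) (+ x) (+ y) ⟩
    + x ℤ.* + m - + y ℤ.* + n
      ≡⟨ cong₂ _-_ (ℤP.pos-* x m) (ℤP.pos-* y n) ⟨
    + (x ℕ.* m) - + (y ℕ.* n)
      ≡⟨ cong (λ t → + t - + (y ℕ.* n)) eq ⟨
    1ℤ ℤ.+ + (y ℕ.* n) - + (y ℕ.* n)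
      ≡⟨ solve 1 (λ a → con 1ℤ :+ a :- a := con 1ℤ) refl (+ (y ℕ.* n)) ⟩
    1ℤ ∎

  abs-unit : ∀ i → Σ ℤ λ u → u ℤ.* i ≡ + ∣ i ∣
  abs-unit (+ n) = 1ℤ , ℤP.*-identityˡ (+ n)
  abs-unit -[1+ n ] = -1ℤ , ℤP.-1*i≡-i -[1+ n ]

  ℕ-coprime⇒bézout : ∀ {m n} → ℕC.Coprime m n →
                     Σ ℤ λ c → Σ ℤ λ d → + m ℤ.* c ℤ.+ + n ℤ.* d ≡ 1ℤ
  ℕ-coprime⇒bézout {m} {n} m⊥n with ℕC.coprime-Bézout m⊥n
  ... | Bézout.+- x y eq = + x , ℤ.- + y , 1+yn≡xm⇒mx-ny≡1 m n x y eq
  ... | Bézout.-+ x y eq = ℤ.- + x , + y ,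
    trans (ℤP.+-comm (+ m ℤ.* ℤ.- + x) (+ n ℤ.* + y)) (1+yn≡xm⇒mx-ny≡1 n m y x eq)

  coprime⇒bézout : ∀ {i j} → Coprime i j → Σ ℤ λ c → Σ ℤ λ d → i ℤ.* c ℤ.+ j ℤ.* d ≡ 1ℤ
  coprime⇒bézout {i} {j} i⊥j with ℕ-coprime⇒bézout i⊥j | abs-unit i | abs-unit j
  ... | c , d , eq | u , ui≡∣i∣ | v , vj≡∣j∣ = u ℤ.* c , v ℤ.* d , (begin
    i ℤ.* (u ℤ.* c) ℤ.+ j ℤ.* (v ℤ.* d)
      ≡⟨ solve 6 (λ i j u v c d → i :* (u :* c) :+ j :* (v :* d) := (u :* i) :* c :+ (v :* j) :* d)
                 refl i j u v c d ⟩
    (u ℤ.* i) ℤ.* c ℤ.+ (v ℤ.* j) ℤ.* d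
      ≡⟨ cong₂ (λ s t → s ℤ.* c ℤ.+ t ℤ.* d) ui≡∣i∣ vj≡∣j∣ ⟩
    + ∣ i ∣ ℤ.* c ℤ.+ + ∣ j ∣ ℤ.* d
      ≡⟨ eq ⟩
    1ℤ ∎)

ι : ℤ → ℚ
ι z = z / 1

ι≡fromℤ : ∀ z → ι z ≡ fromℤ z
ι≡fromℤ z = ℚP.↥p/↧p≡p (fromℤ z)

ι-injective : ∀ {a b} → ι a ≡ ι b → a ≡ b
ι-injective {a} {b} e = cong ↥_ (trans (sym (ι≡fromℤ a)) (trans e (ι≡fromℤ b)))

ι-homo-* : ∀ a b → ι (a ℤ.* b) ≡ ι a ℚ.* ι b
ι-homo-* a b rewrite ι≡fromℤ a | ι≡fromℤ b = refl

ι-homo-+ : ∀ a b → ι (a ℤ.+ b) ≡ ι a ℚ.+ ι b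
ι-homo-+ a b rewrite ι≡fromℤ a | ι≡fromℤ b =
  cong₂ (λ x y → (x ℤ.+ y) / 1) (sym (ℤP.*-identityʳ a)) (sym (ℤP.*-identityʳ b))

ι-homo-*+* : ∀ a b c d → ι (a ℤ.* c ℤ.+ b ℤ.* d) ≡ ι a ℚ.* ι c ℚ.+ ι b ℚ.* ι d
ι-homo-*+* a b c d =
  trans (ι-homo-+ (a ℤ.* c) (b ℤ.* d)) (cong₂ ℚ._+_ (ι-homo-* a c) (ι-homo-* b d))

p*↧p≡↥p : ∀ p → p ℚ.* ι (↧ p) ≡ ι (↥ p)
p*↧p≡↥p p@(mkℚ n d _) rewrite ι≡fromℤ (↧ p) | ι≡fromℤ (↥ p) =
  ℚP.toℚᵘ-injective
    (ℚᵘP.≃-trans (ℚP.toℚᵘ-homo-* p (fromℤ (↧ p))) (ℚᵘ.*≡* (ℤP.*-assoc n (+ suc d) 1ℤ)))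

∃ℤ[_] : ∀ {k} → QF (suc k) → ℚ → Set
∃ℤ[_] {k} χ q = Σ (Vector ℤ k) λ zs → Sat (q ∷ map ι zs) χ

ExDefinable-∃ℤ : ExDefinable IsInt → ∀ {k} (χ : QF (suc k)) → ExDefinable ∃ℤ[ χ ]
ExDefinable-∃ℤ (m , φ , defℤ) {k} χ = k ℕ.* suc m , ψ , λ q → mk⇔ (intro q) (elim q)
  where
  -- Block i of the new variables holds the integer zᵢ followed by witnesses ȳ for φ(zᵢ, ȳ).
  block : Fin k → Fin (suc m) → Fin (suc (k ℕ.* suc m))
  block i j = suc (combine i j)

  χ-vars : Fin (suc k) → Fin (suc (k ℕ.* suc m))
  χ-vars = zero ∷ λ i → block i zero

  ψ : QF (suc (k ℕ.* suc m))
  ψ = renQ χ-vars χ ∧′ ⋀ (λ i → renQ (block i) φ)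

  intro : ∀ q → ∃ℤ[ χ ] q → Σ (Vector ℚ (k ℕ.* suc m)) λ ys → Sat (q ∷ ys) ψ
  intro q (zs , satχ) =
    concat blocks
    , from (Sat-renQ χ-vars≗ χ) satχ
    , from (Sat-⋀ _) (λ i → from (Sat-renQ (concat-combine blocks i) φ) (proj₂ (witness i)))
    where
    witness : ∀ i → Σ (Vector ℚ m) λ ws → Sat (ι (zs i) ∷ ws) φ
    witness i = to (defℤ (ι (zs i))) (zs i , refl)
    blocks : Vector (Vector ℚ (suc m)) k
    blocks i = ι (zs i) ∷ proj₁ (witness i)
    χ-vars≗ : ∀ i → (q ∷ concat blocks) (χ-vars i) ≡ (q ∷ map ι zs) i
    χ-vars≗ zero = refl
    χ-vars≗ (suc i) = concat-combine blocks i zero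

  elim : ∀ q → (Σ (Vector ℚ (k ℕ.* suc m)) λ ys → Sat (q ∷ ys) ψ) → ∃ℤ[ χ ] q
  elim q (ys , satχ , satφs) = zs , to (Sat-renQ χ-vars≗ χ) satχ
    where
    integral : ∀ i → IsInt (ys (combine i zero))
    integral i = from (defℤ _) (ys ∘ combine i ∘ suc , to (Sat-renQ head∷tail φ) (to (Sat-⋀ _) satφs i))
      where
      head∷tail : ∀ j → (q ∷ ys) (block i j) ≡ (ys (combine i zero) ∷ (ys ∘ combine i ∘ suc)) j
      head∷tail zero = refl
      head∷tail (suc j) = refl
    zs : Vector ℤ k
    zs = proj₁ ∘ integral
    χ-vars≗ : ∀ i → (q ∷ ys) (χ-vars i) ≡ (q ∷ map ι zs) i
    χ-vars≗ zero = refl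
    χ-vars≗ (suc i) = proj₂ (integral i)

nonIntegrality : QF 5
nonIntegrality = ((x ⊗ b) ≐ a) ∧′ ((((a ⊗ c) ⊕ (b ⊗ d)) ≐ one′) ∧′ (¬′ ((b ⊗ b) ≐ one′)))
  where
  x a b c d : Term 5
  x = var (# 0)
  a = var (# 1)
  b = var (# 2)
  c = var (# 3)
  d = var (# 4)

NonIntegral : ℚ → Set
NonIntegral = ∃ℤ[ nonIntegrality ]

IsInt⇒¬NonIntegral : ∀ {q} → IsInt q → ¬ NonIntegral q
IsInt⇒¬NonIntegral (z , refl) (zs , zb≡a , ac+bd≡1 , b²≢1) =
  b²≢1 (trans (sym (ι-homo-* b b)) (cong ι (denominator-unit z a b c d
    (ι-injective (trans (ι-homo-* z b) zb≡a))
    (ι-injective (trans (ι-homo-*+* a b c d) ac+bd≡1)))))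
  where
  a b c d : ℤ
  a = zs (# 0)
  b = zs (# 1)
  c = zs (# 2)
  d = zs (# 3)

IsInt⊎NonIntegral : ∀ q → IsInt q ⊎ NonIntegral q
IsInt⊎NonIntegral q@(mkℚ a zero _) = inj₁ (a , sym (ℚP.↥p/↧p≡p q))
IsInt⊎NonIntegral q@(mkℚ a (suc _) a⊥b) =
  inj₂ ((a ∷ b ∷ c ∷ d ∷ [])
       , p*↧p≡↥p q
       , trans (sym (ι-homo-*+* a b c d)) (cong ι ac+bd≡1)
       , b²≢1)
  where
  b : ℤ
  b = ↧ q
  bézout : Σ ℤ λ c → Σ ℤ λ d → a ℤ.* c ℤ.+ b ℤ.* d ≡ 1ℤ
  bézout = coprime⇒bézout {a} {b} (recompute (coprime? a b) a⊥b)
  c d : ℤ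
  c = proj₁ bézout
  d = proj₁ (proj₂ bézout)
  ac+bd≡1 : a ℤ.* c ℤ.+ b ℤ.* d ≡ 1ℤ
  ac+bd≡1 = proj₂ (proj₂ bézout)
  b²≢1 : ¬ (ι b ℚ.* ι b ≡ 1ℚ)
  b²≢1 e with ι-injective {b ℤ.* b} {1ℤ} (trans (ι-homo-* b b) e)
  ... | ()

IsInt⇔¬NonIntegral : ∀ q → IsInt q ⇔ (¬ NonIntegral q)
IsInt⇔¬NonIntegral q = mk⇔ IsInt⇒¬NonIntegral λ ¬nonIntegral →
  [ id , (λ nonIntegral → contradiction nonIntegral ¬nonIntegral) ]′ (IsInt⊎NonIntegral q)

mainTheorem2 : ExistentiallyDefinableℤ → UniversallyDefinableℤ
mainTheorem2 defℤ =
  UnDefinable-complement (ExDefinable-∃ℤ defℤ nonIntegrality) IsInt⇔¬NonIntegral
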